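{- Let $P$ be a point of $\Sigma=\mathrm{PG}(n,q)$ and let $K$ be a set of points of $\Sigma$ such that every hyperplane of $\Sigma$ not containing $P$ meets $K$ in the same number of points. Then $K\cup\{P\}$ is a cone with vertex $P$.
   Context: A cone with vertex a subspace $V$ is a point set $C\supseteq V$ such that for every $X\in C$ and $Q\in V$ all points of the line $XQ$ lie in $C$. -}

module Defs where

open import Data.Nat using (ℕ; suc)
open import Data.Fin using (Fin)
open import Data.Vec using (Vec; []; _∷_; map; zipWith)
open import Data.Bool using (Bool; true)
open import Data.Sum using (_⊎_)
open import Data.Product using (Σ; ∃-syntax; _×_; proj₁)
open import Relation.Binary.PropositionalEquality using (_≡_)
open import Relation.Nullary using (¬_)
open import Algebra.Structures using (IsCommutativeRing)
open import Function.Bundles using (_↔_)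

record FiniteField (q : ℕ) : Set₁ where
  field
    Carrier : Set
    _+_ _*_ : Carrier → Carrier → Carrier
    -_      : Carrier → Carrier
    0# 1#   : Carrier
    isCommutativeRing : IsCommutativeRing _≡_ _+_ _*_ -_ 0# 1#
    0≢1     : ¬ (0# ≡ 1#)
    inverse : ∀ x → ¬ (x ≡ 0#) → ∃[ y ] (x * y ≡ 1#)
    enumeration : Fin q ↔ Carrier

module Projective {q : ℕ} (F : FiniteField q) (n : ℕ) where
  open FiniteField F

  data Normalised : {m : ℕ} → Vec Carrier m → Set where
    lead : ∀ {m} {xs : Vec Carrier m} → Normalised (1# ∷ xs)
    skip : ∀ {m} {xs : Vec Carrier m} → Normalised xs → Normalised (0# ∷ xs)

  -- points of PG(n,q), each represented by its unique normalised
  -- homogeneous coordinate vector in F^(n+1)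
  Point : Set
  Point = Σ (Vec Carrier (suc n)) Normalised

  coords : Point → Vec Carrier (suc n)
  coords = proj₁

  -- hyperplanes of PG(n,q): { x | Σ_i a_i x_i = 0 } for a nonzero a,
  -- each represented by its unique normalised coefficient vector a
  Hyperplane : Set
  Hyperplane = Σ (Vec Carrier (suc n)) Normalised

  dot : {m : ℕ} → Vec Carrier m → Vec Carrier m → Carrier
  dot []       []       = 0#
  dot (a ∷ as) (x ∷ xs) = (a * x) + dot as xs

  _∈H_ : Point → Hyperplane → Set
  x ∈H h = dot (proj₁ h) (coords x) ≡ 0#

  PointSet : Set
  PointSet = Point → Bool

  _∩_ : PointSet → Hyperplane → Set
  K ∩ h = Σ Point (λ x → (K x ≡ true) × (x ∈H h))

  InsertPt : PointSet → Point → Point → Set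
  InsertPt K P x = (K x ≡ true) ⊎ (x ≡ P)

  OnLine : Point → Point → Point → Set
  OnLine X Q Y = ∃[ a ] ∃[ b ]
    (coords Y ≡ zipWith _+_ (map (a *_) (coords X)) (map (b *_) (coords Q)))

  -- C is a cone with vertex the point P (a 0-dimensional subspace):
  -- P ∈ C, and for every X ∈ C with X ≠ P all points of the line XP lie in C
  -- (for X = P the condition is vacuous: every point of the vertex is in C).
  IsConeWithVertex : (Point → Set) → Point → Set
  IsConeWithVertex C P =
    C P × (∀ X → C X → ¬ (X ≡ P) → ∀ Y → OnLine X P Y → C Y)

-- Let X ∈ K with X ≠ P, and let Y ≠ P, X be a point of the line XP; suppose Y ∉ K.
-- Write the hyperplanes missing P as a·v = 0 with a·p = 1, and double count the pairs
-- (z, a) with z ∈ K on the hyperplane a, once for the hyperplanes through X and once for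
-- those through Y. Translating a by a functional that vanishes at P and is 1 at X maps
-- the first family bijectively onto the second, and all these hyperplanes meet K equally
-- often, so the two counts agree. Counted by points, the same translation (chosen to
-- vanish at z as well) matches the contributions of every z off the line XP; on that line
-- z ≠ X, Y contributes to neither count, Y ∉ K contributes nothing, and X contributes to
-- the first count only. So a finite set would be in bijection with itself plus a point.

module Submission where

open import Defs

open import Axiom.UniquenessOfIdentityProofs.WithK using (uip)
open import Algebra.Bundles using (CommutativeRing)
import Algebra.Properties.Group as GroupProperties
import Algebra.Properties.Ring as RingProperties
import Data.Bool as Bool
open Bool using (true; false)
open import Data.Empty using (⊥; ⊥-elim)
import Data.Fin as Fin
open Fin using (Fin; zero; suc)
open import Data.Fin.Properties using (0↔⊥; 1↔⊤; +↔⊎; injective⇒≤)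
open import Data.Nat as ℕ using (ℕ; zero; suc)
open import Data.Nat.Properties using (1+n≰n)
open import Data.Product using (Σ; ∃-syntax; _×_; _,_; proj₁; proj₂)
open import Data.Product.Function.Dependent.Propositional using (Σ-↔)
open import Data.Product.Function.NonDependent.Propositional using (_×-↔_; _×-⇔_)
import Data.Sum as Sum
open Sum using (_⊎_; inj₁; inj₂; [_,_])
open import Data.Sum.Function.Propositional using (_⊎-↔_)
open import Data.Sum.Properties using (inj₁-injective)
open import Data.Vec using (Vec; []; _∷_; map; zipWith; replicate)
open import Data.Vec.Properties using (∷-injective; ≡-dec)
import Data.Vec.Relation.Unary.All as All
open All using (All; []; _∷_)
open import Function using (_∘_; id)
open import Function.Bundles using (_↔_; _⇔_; Inverse; Injection; Equivalence; mk↔ₛ′; mk⇔)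
open import Function.Properties.Inverse using (↔-refl; ↔-sym; ↔-trans; Inverse⇒Injection)
open import Level using (0ℓ)
open import Relation.Binary.Definitions using (DecidableEquality)
open import Relation.Binary.PropositionalEquality hiding ([_])
open import Relation.Nullary using (¬_; Dec; yes; no; Irrelevant)
open import Relation.Nullary.Decidable using (True-↔; via-injection; _×-dec_; map′)

Finite : Set → Set
Finite A = ∃[ k ] (A ↔ Fin k)

finite-↔ : {A B : Set} → A ↔ B → Finite B → Finite A
finite-↔ A↔B (k , B↔Fin) = k , ↔-trans A↔B B↔Fin

finite-Dec : {A : Set} → Dec A → Irrelevant A → Finite A
finite-Dec a? irr with True-↔ a? irr
finite-Dec (yes _) irr | ⊤↔A = 1 , ↔-trans (↔-sym ⊤↔A) (↔-sym 1↔⊤)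
finite-Dec (no _)  irr | ⊥↔A = 0 , ↔-trans (↔-sym ⊥↔A) (↔-sym 0↔⊥)

Σ-Fin-suc-↔ : ∀ {m} {B : Fin (suc m) → Set} → Σ (Fin (suc m)) B ↔ (B zero ⊎ Σ (Fin m) (B ∘ suc))
Σ-Fin-suc-↔ = mk↔ₛ′
  (λ { (zero , b) → inj₁ b ; (suc i , b) → inj₂ (i , b) })
  (λ { (inj₁ b) → zero , b ; (inj₂ (i , b)) → suc i , b })
  (λ { (inj₁ _) → refl ; (inj₂ _) → refl })
  (λ { (zero , _) → refl ; (suc _ , _) → refl })

finite-Σ-Fin : ∀ m {B : Fin m → Set} → (∀ i → Finite (B i)) → Finite (Σ (Fin m) B)
finite-Σ-Fin zero    fin = 0 , mk↔ₛ′ (λ ()) (λ ()) (λ ()) (λ ())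
finite-Σ-Fin (suc m) fin with fin zero | finite-Σ-Fin m (fin ∘ suc)
... | k , B₀↔Fin | l , Bₛ↔Fin =
  k ℕ.+ l , ↔-trans Σ-Fin-suc-↔ (↔-trans (B₀↔Fin ⊎-↔ Bₛ↔Fin) (↔-sym +↔⊎))

finite-Σ : {A : Set} {B : A → Set} → Finite A → (∀ a → Finite (B a)) → Finite (Σ A B)
finite-Σ (m , A↔Fin) fin =
  finite-↔ (↔-sym (Σ-↔ (↔-sym A↔Fin) ↔-refl)) (finite-Σ-Fin m (fin ∘ Inverse.from A↔Fin))

finite-Vec : {A : Set} → Finite A → ∀ n → Finite (Vec A n)
finite-Vec fin zero    = 1 , mk↔ₛ′ (λ _ → zero) (λ _ → []) (λ { zero → refl }) (λ { [] → refl })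
finite-Vec fin (suc n) = finite-↔ ∷-↔ (finite-Σ fin (λ _ → finite-Vec fin n))
  where
  ∷-↔ : Vec _ (suc n) ↔ (_ × Vec _ n)
  ∷-↔ = mk↔ₛ′ (λ { (a ∷ as) → a , as }) (λ (a , as) → a ∷ as) (λ _ → refl) (λ { (_ ∷ _) → refl })

finite-absorbs⇒empty : {A B : Set} → Finite A → (A ⊎ B) ↔ A → ¬ B
finite-absorbs⇒empty {A} {B} (k , A↔Fin) A⊎B↔A b = 1+n≰n (injective⇒≤ {f = embed} embed-injective)
  where
  open Inverse
  to-injective : ∀ {S T : Set} (e : S ↔ T) {s s′} → to e s ≡ to e s′ → s ≡ s′
  to-injective e = Injection.injective (Inverse⇒Injection e)
  extend : Fin (suc k) → A ⊎ B
  extend zero    = inj₂ b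
  extend (suc i) = inj₁ (from A↔Fin i)
  extend-injective : ∀ {i j} → extend i ≡ extend j → i ≡ j
  extend-injective {zero}  {zero}  _  = refl
  extend-injective {zero}  {suc _} ()
  extend-injective {suc _} {zero}  ()
  extend-injective {suc i} {suc j} eq = cong suc (to-injective (↔-sym A↔Fin) (inj₁-injective eq))
  embed : Fin (suc k) → Fin k
  embed = to A↔Fin ∘ to A⊎B↔A ∘ extend
  embed-injective : ∀ {i j} → embed i ≡ embed j → i ≡ j
  embed-injective = extend-injective ∘ to-injective A⊎B↔A ∘ to-injective A↔Fin

×-irrelevant : {A B : Set} → Irrelevant A → Irrelevant B → Irrelevant (A × B)
×-irrelevant irrA irrB (a , b) (a′ , b′) = cong₂ _,_ (irrA a a′) (irrB b b′)

⇔⇒↔ : {A B : Set} → Irrelevant A → Irrelevant B → A ⇔ B → A ↔ B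
⇔⇒↔ irrA irrB A⇔B =
  mk↔ₛ′ (Equivalence.to A⇔B) (Equivalence.from A⇔B) (λ _ → irrB _ _) (λ _ → irrA _ _)

¬-↔ : {A B : Set} → ¬ A → ¬ B → A ↔ B
¬-↔ ¬A ¬B = mk↔ₛ′ (⊥-elim ∘ ¬A) (⊥-elim ∘ ¬B) (⊥-elim ∘ ¬B) (⊥-elim ∘ ¬A)

Σ-split : {A : Set} {W W′ : A → Set} (x : A) → DecidableEquality A →
          (∀ a → ¬ a ≡ x → W a ↔ W′ a) → ¬ W′ x → Σ A W ↔ (Σ A W′ ⊎ W x)
Σ-split {A} {W} {W′} x _≟_ W↔W′ ¬W′x =
  ↔-trans (Σ-↔ ↔-refl (λ {a} → fibre a)) (mk↔ₛ′ to from to∘from from∘to)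
  where
  fibre : ∀ a → W a ↔ (W′ a ⊎ (a ≡ x × W x))
  fibre a with a ≟ x
  ... | yes refl = mk↔ₛ′ (λ w → inj₂ (refl , w)) [ ⊥-elim ∘ ¬W′x , proj₂ ]
    (λ { (inj₁ w′) → ⊥-elim (¬W′x w′) ; (inj₂ (x≡x , _)) → cong (λ e → inj₂ (e , _)) (uip refl x≡x) })
    (λ _ → refl)
  ... | no a≢x   = ↔-trans (W↔W′ a a≢x) (mk↔ₛ′ inj₁ [ id , ⊥-elim ∘ a≢x ∘ proj₁ ]
    (λ { (inj₁ _) → refl ; (inj₂ (a≡x , _)) → ⊥-elim (a≢x a≡x) })
    (λ _ → refl))
  to : Σ A (λ a → W′ a ⊎ (a ≡ x × W x)) → Σ A W′ ⊎ W x
  to (a , inj₁ w′)      = inj₁ (a , w′)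
  to (a , inj₂ (_ , w)) = inj₂ w
  from : Σ A W′ ⊎ W x → Σ A (λ a → W′ a ⊎ (a ≡ x × W x))
  from (inj₁ (a , w′)) = a , inj₁ w′
  from (inj₂ w)        = x , inj₂ (refl , w)
  to∘from : ∀ w → to (from w) ≡ w
  to∘from (inj₁ _) = refl
  to∘from (inj₂ _) = refl
  from∘to : ∀ w → from (to w) ≡ w
  from∘to (a , inj₁ _)          = refl
  from∘to (a , inj₂ (refl , _)) = refl

module Field {q : ℕ} (F : FiniteField q) where

  open FiniteField F using (isCommutativeRing; inverse; enumeration; 0≢1)

  commutativeRing : CommutativeRing 0ℓ 0ℓ
  commutativeRing = record { isCommutativeRing = isCommutativeRing }

  open CommutativeRing commutativeRing public
    using (Carrier; _+_; _*_; -_; 0#; 1#; *-assoc; *-comm; *-identityˡ; *-identityʳ; zeroˡ; zeroʳ;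
           +-identityˡ; +-identityʳ; -‿inverseˡ; -‿inverseʳ)
  open RingProperties (CommutativeRing.ring commutativeRing) public using (-‿distribˡ-*)
  open GroupProperties (CommutativeRing.+-group commutativeRing) public using (∙-cancelˡ; ∙-cancelʳ)

  -- Coefficients in ℕ: normalising with coefficients in F itself would have to decide
  -- equality in an abstract field. Negated terms are passed to the solver as atoms.
  open import Algebra.Solver.Ring.NaturalCoefficients.Default
    (CommutativeRing.commutativeSemiring commutativeRing) public using (solve; _:=_; _:+_; _:*_)

  _≟_ : DecidableEquality Carrier
  _≟_ = via-injection (Inverse⇒Injection (↔-sym enumeration)) Fin._≟_

  finite-Carrier : Finite Carrier
  finite-Carrier = q , ↔-sym enumeration

  1≢0 : ¬ 1# ≡ 0#
  1≢0 = 0≢1 ∘ sym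

  ≡1⇒≢0 : ∀ {x} → x ≡ 1# → ¬ x ≡ 0#
  ≡1⇒≢0 x≡1 x≡0 = 1≢0 (trans (sym x≡1) x≡0)

  inv : (x : Carrier) → ¬ x ≡ 0# → Carrier
  inv x x≢0 = proj₁ (inverse x x≢0)

  x*inv≡1 : ∀ x (x≢0 : ¬ x ≡ 0#) → x * inv x x≢0 ≡ 1#
  x*inv≡1 x x≢0 = proj₂ (inverse x x≢0)

  inv*x≡1 : ∀ x (x≢0 : ¬ x ≡ 0#) → inv x x≢0 * x ≡ 1#
  inv*x≡1 x x≢0 = trans (*-comm (inv x x≢0) x) (x*inv≡1 x x≢0)

  inv≢0 : ∀ x (x≢0 : ¬ x ≡ 0#) → ¬ inv x x≢0 ≡ 0#
  inv≢0 x x≢0 inv≡0 = 1≢0 (trans (sym (x*inv≡1 x x≢0)) (trans (cong (x *_) inv≡0) (zeroʳ x)))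

  x*y≡0⇒y≡0 : ∀ {x y} → ¬ x ≡ 0# → x * y ≡ 0# → y ≡ 0#
  x*y≡0⇒y≡0 {x} {y} x≢0 xy≡0 = begin
    y               ≡⟨ sym (*-identityˡ y) ⟩
    1# * y          ≡⟨ cong (_* y) (sym (inv*x≡1 x x≢0)) ⟩
    x⁻¹ * x * y     ≡⟨ *-assoc x⁻¹ x y ⟩
    x⁻¹ * (x * y)   ≡⟨ cong (x⁻¹ *_) xy≡0 ⟩
    x⁻¹ * 0#        ≡⟨ zeroʳ x⁻¹ ⟩
    0#              ∎
    where
    open ≡-Reasoning
    x⁻¹ : Carrier
    x⁻¹ = inv x x≢0

  *-nonzero : ∀ {x y} → ¬ x ≡ 0# → ¬ y ≡ 0# → ¬ x * y ≡ 0#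
  *-nonzero x≢0 y≢0 = y≢0 ∘ x*y≡0⇒y≡0 x≢0

  -x*y≡-y*x : ∀ x y → - x * y ≡ - y * x
  -x*y≡-y*x x y = trans (sym (-‿distribˡ-* x y)) (trans (cong -_ (*-comm x y)) (-‿distribˡ-* y x))

module Geometry {q : ℕ} (F : FiniteField q) (n : ℕ) where

  open Field F
  open Projective F n
  open ≡-Reasoning

  infixl 6 _⊕_
  infixr 7 _⊛_

  _⊕_ : ∀ {m} → Vec Carrier m → Vec Carrier m → Vec Carrier m
  _⊕_ = zipWith _+_

  _⊛_ : ∀ {m} → Carrier → Vec Carrier m → Vec Carrier m
  c ⊛ v = map (c *_) v

  0ᵛ : ∀ {m} → Vec Carrier m
  0ᵛ = replicate _ 0#

  ⊕-identityˡ : ∀ {m} (v : Vec Carrier m) → 0ᵛ ⊕ v ≡ v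
  ⊕-identityˡ []      = refl
  ⊕-identityˡ (a ∷ v) = cong₂ _∷_ (+-identityˡ a) (⊕-identityˡ v)

  ⊕-identityʳ : ∀ {m} (v : Vec Carrier m) → v ⊕ 0ᵛ ≡ v
  ⊕-identityʳ []      = refl
  ⊕-identityʳ (a ∷ v) = cong₂ _∷_ (+-identityʳ a) (⊕-identityʳ v)

  0⊛-zero : ∀ {m} (v : Vec Carrier m) → 0# ⊛ v ≡ 0ᵛ
  0⊛-zero []      = refl
  0⊛-zero (a ∷ v) = cong₂ _∷_ (zeroˡ a) (0⊛-zero v)

  1⊛-identity : ∀ {m} (v : Vec Carrier m) → 1# ⊛ v ≡ v
  1⊛-identity []      = refl
  1⊛-identity (a ∷ v) = cong₂ _∷_ (*-identityˡ a) (1⊛-identity v)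

  0⊛-⊕ : ∀ {m} (w v : Vec Carrier m) → 0# ⊛ w ⊕ v ≡ v
  0⊛-⊕ w v = trans (cong (_⊕ v) (0⊛-zero w)) (⊕-identityˡ v)

  ⊕-0⊛ : ∀ {m} (v w : Vec Carrier m) → v ⊕ 0# ⊛ w ≡ v
  ⊕-0⊛ v w = trans (cong (v ⊕_) (0⊛-zero w)) (⊕-identityʳ v)

  ⊛-cancel : ∀ {m} {d e} (a u : Vec Carrier m) → d + e ≡ 0# → a ⊕ d ⊛ u ⊕ e ⊛ u ≡ a
  ⊛-cancel []       []       _     = refl
  ⊛-cancel {d = d} {e} (a ∷ as) (b ∷ bs) d+e≡0 = cong₂ _∷_ head (⊛-cancel as bs d+e≡0)
    where
    head : a + d * b + e * b ≡ a
    head = begin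
      a + d * b + e * b   ≡⟨ solve 4 (λ a d e b → a :+ d :* b :+ e :* b := a :+ (d :+ e) :* b) refl a d e b ⟩
      a + (d + e) * b     ≡⟨ cong (λ s → a + s * b) d+e≡0 ⟩
      a + 0# * b          ≡⟨ cong (a +_) (zeroˡ b) ⟩
      a + 0#              ≡⟨ +-identityʳ a ⟩
      a                   ∎

  line-scale : ∀ {m} {c μ c′ μ′} d (u v : Vec Carrier m) → c ≡ d * c′ → μ ≡ d * μ′ →
               c ⊛ u ⊕ μ ⊛ v ≡ d ⊛ (c′ ⊛ u ⊕ μ′ ⊛ v)
  line-scale d []      []      _    _    = refl
  line-scale {c′ = c′} {μ′} d (a ∷ u) (b ∷ v) refl refl = cong₂ _∷_
    (solve 5 (λ d c′ μ′ a b → d :* c′ :* a :+ d :* μ′ :* b := d :* (c′ :* a :+ μ′ :* b)) refl d c′ μ′ a b)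
    (line-scale d u v refl refl)

  translation : Carrier → Vec Carrier (suc n) → Vec Carrier (suc n) ↔ Vec Carrier (suc n)
  translation d u = mk↔ₛ′ (λ a → a ⊕ d ⊛ u) (λ a → a ⊕ (- d) ⊛ u)
    (λ a → ⊛-cancel a u (-‿inverseˡ d)) (λ a → ⊛-cancel a u (-‿inverseʳ d))

  dot-comm : ∀ {m} (a v : Vec Carrier m) → dot a v ≡ dot v a
  dot-comm []       []       = refl
  dot-comm (a ∷ as) (v ∷ vs) = cong₂ _+_ (*-comm a v) (dot-comm as vs)

  dot-zeroʳ : ∀ {m} (a : Vec Carrier m) → dot a 0ᵛ ≡ 0#
  dot-zeroʳ []       = refl
  dot-zeroʳ (a ∷ as) = trans (cong₂ _+_ (zeroʳ a) (dot-zeroʳ as)) (+-identityʳ 0#)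

  dot-zeroˡ : ∀ {m} (v : Vec Carrier m) → dot 0ᵛ v ≡ 0#
  dot-zeroˡ v = trans (dot-comm 0ᵛ v) (dot-zeroʳ v)

  dot-⊕ʳ : ∀ {m} (a u v : Vec Carrier m) → dot a (u ⊕ v) ≡ dot a u + dot a v
  dot-⊕ʳ []       []       []       = sym (+-identityʳ 0#)
  dot-⊕ʳ (a ∷ as) (u ∷ us) (v ∷ vs) = begin
    a * (u + v) + dot as (us ⊕ vs)             ≡⟨ cong (a * (u + v) +_) (dot-⊕ʳ as us vs) ⟩
    a * (u + v) + (dot as us + dot as vs)      ≡⟨ solve 5 (λ a u v s t → a :* (u :+ v) :+ (s :+ t) := (a :* u :+ s) :+ (a :* v :+ t))
                                                        refl a u v (dot as us) (dot as vs) ⟩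
    a * u + dot as us + (a * v + dot as vs)    ∎

  dot-⊛ʳ : ∀ {m} c (a v : Vec Carrier m) → dot a (c ⊛ v) ≡ c * dot a v
  dot-⊛ʳ c []       []       = sym (zeroʳ c)
  dot-⊛ʳ c (a ∷ as) (v ∷ vs) = begin
    a * (c * v) + dot as (c ⊛ vs)   ≡⟨ cong (a * (c * v) +_) (dot-⊛ʳ c as vs) ⟩
    a * (c * v) + c * dot as vs     ≡⟨ solve 4 (λ a c v s → a :* (c :* v) :+ c :* s := c :* (a :* v :+ s))
                                               refl a c v (dot as vs) ⟩
    c * (a * v + dot as vs)         ∎

  dot-⊛ˡ : ∀ {m} c (a v : Vec Carrier m) → dot (c ⊛ a) v ≡ c * dot a v
  dot-⊛ˡ c a v = trans (dot-comm (c ⊛ a) v) (trans (dot-⊛ʳ c v a) (cong (c *_) (dot-comm v a)))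

  dot-lineʳ : ∀ {m} c d (a u v : Vec Carrier m) → dot a (c ⊛ u ⊕ d ⊛ v) ≡ c * dot a u + d * dot a v
  dot-lineʳ c d a u v = trans (dot-⊕ʳ a (c ⊛ u) (d ⊛ v)) (cong₂ _+_ (dot-⊛ʳ c a u) (dot-⊛ʳ d a v))

  dot-shiftʳ : ∀ {m} d (a u v : Vec Carrier m) → dot a (u ⊕ d ⊛ v) ≡ dot a u + d * dot a v
  dot-shiftʳ d a u v = trans (dot-⊕ʳ a u (d ⊛ v)) (cong (dot a u +_) (dot-⊛ʳ d a v))

  dot-shiftˡ : ∀ {m} d (a u v : Vec Carrier m) → dot (a ⊕ d ⊛ u) v ≡ dot a v + d * dot u v
  dot-shiftˡ d a u v = begin
    dot (a ⊕ d ⊛ u) v          ≡⟨ dot-comm (a ⊕ d ⊛ u) v ⟩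
    dot v (a ⊕ d ⊛ u)          ≡⟨ dot-shiftʳ d v a u ⟩
    dot v a + d * dot v u      ≡⟨ cong₂ (λ r s → r + d * s) (dot-comm v a) (dot-comm v u) ⟩
    dot a v + d * dot u v      ∎

  dot-translation : ∀ {m d r e} (a u v : Vec Carrier m) → dot a v ≡ r → dot u v ≡ e →
                    dot (a ⊕ d ⊛ u) v ≡ r + d * e
  dot-translation {d = d} a u v av≡r uv≡e = trans (dot-shiftˡ d a u v) (cong₂ (λ s w → s + d * w) av≡r uv≡e)

  translation-value : ∀ {m d r e r′} (a u v : Vec Carrier m) → dot u v ≡ e → r + d * e ≡ r′ →
                      dot a v ≡ r ⇔ dot (a ⊕ d ⊛ u) v ≡ r′
  translation-value {d = d} {r} {e} a u v uv≡e r+de≡r′ = mk⇔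
    (λ av≡r → trans (dot-translation a u v av≡r uv≡e) r+de≡r′)
    (λ av′≡r′ → ∙-cancelʳ (d * e) (dot a v) r
      (trans (sym (dot-translation a u v refl uv≡e)) (trans av′≡r′ (sym r+de≡r′))))

  combination : ∀ {m r} → Vec Carrier r → Vec (Vec Carrier m) r → Vec Carrier m
  combination []       []       = 0ᵛ
  combination (c ∷ cs) (v ∷ vs) = combination cs vs ⊕ c ⊛ v

  _∈Span_ : ∀ {m r} → Vec Carrier m → Vec (Vec Carrier m) r → Set
  z ∈Span vs = ∃[ cs ] z ≡ combination cs vs

  Annihilates : ∀ {m r} → Vec Carrier m → Vec (Vec Carrier m) r → Set
  Annihilates u vs = All (λ v → dot u v ≡ 0#) vs

  Separable : ∀ {m r} → Vec (Vec Carrier m) r → Vec Carrier m → Set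
  Separable vs z = ∃[ u ] (Annihilates u vs × dot u z ≡ 1#)

  annihilates-combination : ∀ {m r} (u : Vec Carrier m) (cs : Vec Carrier r) vs →
                            Annihilates u vs → dot u (combination cs vs) ≡ 0#
  annihilates-combination u []       []       []             = dot-zeroʳ u
  annihilates-combination u (c ∷ cs) (v ∷ vs) (uv≡0 ∷ u⊥vs) = begin
    dot u (combination cs vs ⊕ c ⊛ v)         ≡⟨ dot-shiftʳ c u (combination cs vs) v ⟩
    dot u (combination cs vs) + c * dot u v   ≡⟨ cong₂ (λ r s → r + c * s) (annihilates-combination u cs vs u⊥vs) uv≡0 ⟩
    0# + c * 0#                               ≡⟨ trans (+-identityˡ _) (zeroʳ c) ⟩
    0#                                        ∎

  ≡0ᵛ⊎dual : ∀ {m} (z : Vec Carrier m) → z ≡ 0ᵛ ⊎ ∃[ u ] dot u z ≡ 1#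
  ≡0ᵛ⊎dual []      = inj₁ refl
  ≡0ᵛ⊎dual (c ∷ z) with c ≟ 0# | ≡0ᵛ⊎dual z
  ... | yes refl | inj₁ refl       = inj₁ refl
  ... | yes refl | inj₂ (u , uz≡1) = inj₂ (0# ∷ u , trans (cong (_+ dot u z) (zeroˡ 0#)) (trans (+-identityˡ _) uz≡1))
  ... | no c≢0   | _               =
    inj₂ (inv c c≢0 ∷ 0ᵛ , trans (cong₂ _+_ (inv*x≡1 c c≢0) (dot-zeroˡ z)) (+-identityʳ 1#))

  ∈Span⊎Separable : ∀ {m r} (vs : Vec (Vec Carrier m) r) z → z ∈Span vs ⊎ Separable vs z
  ∈Span⊎Separable []       z = Sum.map ([] ,_) (λ (u , uz≡1) → u , [] , uz≡1) (≡0ᵛ⊎dual z)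
  ∈Span⊎Separable (w ∷ vs) z with ∈Span⊎Separable vs w
  ... | inj₁ (ds , w≡) = Sum.map (λ (cs , z≡) → 0# ∷ cs , trans z≡ (sym (⊕-0⊛ _ w)))
                                 (λ (u , u⊥vs , uz≡1) → u , u⊥w u u⊥vs ∷ u⊥vs , uz≡1)
                                 (∈Span⊎Separable vs z)
    where
    u⊥w : ∀ u → Annihilates u vs → dot u w ≡ 0#
    u⊥w u u⊥vs = trans (cong (dot u) w≡) (annihilates-combination u ds vs u⊥vs)
  ... | inj₂ (u′ , u′⊥vs , u′w≡1) = Sum.map reduce-span reduce-separable (∈Span⊎Separable vs z′)
    where
    d : Carrier
    d = dot u′ z
    z′ : Vec Carrier _
    z′ = z ⊕ (- d) ⊛ w
    reduce-span : z′ ∈Span vs → z ∈Span (w ∷ vs)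
    reduce-span (cs , z′≡) = d ∷ cs , trans (sym (⊛-cancel z w (-‿inverseˡ d))) (cong (_⊕ d ⊛ w) z′≡)
    reduce-separable : Separable vs z′ → Separable (w ∷ vs) z
    reduce-separable (u , u⊥vs , uz′≡1) = U , Uw≡0 ∷ All.map U⊥ (All.zip (u⊥vs , u′⊥vs)) , Uz≡1
      where
      e : Carrier
      e = - dot u w
      U : Vec Carrier _
      U = u ⊕ e ⊛ u′
      Uw≡0 : dot U w ≡ 0#
      Uw≡0 = begin
        dot U w                    ≡⟨ dot-translation u u′ w refl u′w≡1 ⟩
        dot u w + e * 1#           ≡⟨ cong (dot u w +_) (*-identityʳ e) ⟩
        dot u w + e                ≡⟨ -‿inverseʳ (dot u w) ⟩
        0#                         ∎
      U⊥ : ∀ {v} → dot u v ≡ 0# × dot u′ v ≡ 0# → dot U v ≡ 0#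
      U⊥ {v} (uv≡0 , u′v≡0) = trans (dot-translation u u′ v uv≡0 u′v≡0) (trans (+-identityˡ _) (zeroʳ e))
      Uz≡1 : dot U z ≡ 1#
      Uz≡1 = begin
        dot U z                    ≡⟨ dot-shiftˡ e u u′ z ⟩
        dot u z + e * d            ≡⟨ cong (dot u z +_) (-x*y≡-y*x (dot u w) d) ⟩
        dot u z + - d * dot u w    ≡⟨ sym (dot-shiftʳ (- d) u z w) ⟩
        dot u z′                   ≡⟨ uz′≡1 ⟩
        1#                         ∎

  normalised-≢0ᵛ : ∀ {m} {v : Vec Carrier m} → Normalised v → ¬ v ≡ 0ᵛ
  normalised-≢0ᵛ lead     v≡0 = 1≢0 (proj₁ (∷-injective v≡0))
  normalised-≢0ᵛ (skip N) v≡0 = normalised-≢0ᵛ N (proj₂ (∷-injective v≡0))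

  -- Matching two proofs of Normalised v directly would need to unify 1# with 0#,
  -- so their indices are related by an explicit equation instead.
  normalised-irrelevant′ : ∀ {m} {u v : Vec Carrier m} (N : Normalised u) (N′ : Normalised v) (u≡v : u ≡ v) →
                           subst Normalised u≡v N ≡ N′
  normalised-irrelevant′ lead     lead      refl = refl
  normalised-irrelevant′ (skip N) (skip N′) refl = cong skip (normalised-irrelevant′ N N′ refl)
  normalised-irrelevant′ lead     (skip _)  u≡v  = ⊥-elim (1≢0 (proj₁ (∷-injective u≡v)))
  normalised-irrelevant′ (skip _) lead      u≡v  = ⊥-elim (1≢0 (sym (proj₁ (∷-injective u≡v))))

  normalised-irrelevant : ∀ {m} {v : Vec Carrier m} → Irrelevant (Normalised v)
  normalised-irrelevant N N′ = normalised-irrelevant′ N N′ refl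

  normalised? : ∀ {m} (v : Vec Carrier m) → Dec (Normalised v)
  normalised? []      = no λ ()
  normalised? (c ∷ v) with c ≟ 1# | c ≟ 0# | normalised? v
  ... | yes refl | _        | _     = yes lead
  ... | no c≢1   | yes refl | yes N = yes (skip N)
  ... | no c≢1   | yes refl | no ¬N = no λ { lead → c≢1 refl ; (skip N) → ¬N N }
  ... | no c≢1   | no c≢0   | _     = no λ { lead → c≢1 refl ; (skip _) → c≢0 refl }

  normalised-proportional : ∀ {m} {u v : Vec Carrier m} {c} → Normalised u → Normalised v → u ≡ c ⊛ v → u ≡ v
  normalised-proportional {u = 1# ∷ u} {1# ∷ v} {c} lead lead u≡cv = cong (1# ∷_) (begin
    u        ≡⟨ proj₂ (∷-injective u≡cv) ⟩
    c ⊛ v    ≡⟨ cong (_⊛ v) (sym (trans (proj₁ (∷-injective u≡cv)) (*-identityʳ c))) ⟩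
    1# ⊛ v   ≡⟨ 1⊛-identity v ⟩
    v        ∎)
  normalised-proportional {c = c} lead (skip _) u≡cv = ⊥-elim (1≢0 (trans (proj₁ (∷-injective u≡cv)) (zeroʳ c)))
  normalised-proportional {u = 0# ∷ u} {1# ∷ v} {c} (skip N) lead u≡cv = ⊥-elim (normalised-≢0ᵛ N (begin
    u        ≡⟨ proj₂ (∷-injective u≡cv) ⟩
    c ⊛ v    ≡⟨ cong (_⊛ v) (sym (trans (proj₁ (∷-injective u≡cv)) (*-identityʳ c))) ⟩
    0# ⊛ v   ≡⟨ 0⊛-zero v ⟩
    0ᵛ       ∎))
  normalised-proportional (skip N) (skip N′) u≡cv =
    cong (0# ∷_) (normalised-proportional N N′ (proj₂ (∷-injective u≡cv)))

  normalise : ∀ {m} (a : Vec Carrier m) → ¬ a ≡ 0ᵛ → ∃[ c ] (¬ c ≡ 0# × Normalised (c ⊛ a))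
  normalise []      a≢0 = ⊥-elim (a≢0 refl)
  normalise (c ∷ a) a≢0 with c ≟ 0#
  ... | yes refl = let d , d≢0 , N = normalise a (a≢0 ∘ cong (0# ∷_))
                   in d , d≢0 , subst (λ h → Normalised (h ∷ d ⊛ a)) (sym (zeroʳ d)) (skip N)
  ... | no c≢0   = inv c c≢0 , inv≢0 c c≢0 ,
                   subst (λ h → Normalised (h ∷ inv c c≢0 ⊛ a)) (sym (inv*x≡1 c c≢0)) lead

  coords-injective : ∀ {X Y : Point} → coords X ≡ coords Y → X ≡ Y
  coords-injective {v , N} {.v , N′} refl = cong (v ,_) (normalised-irrelevant N N′)

  _≟ₚ_ : DecidableEquality Point
  X ≟ₚ Y = map′ coords-injective (cong coords) (≡-dec _≟_ (coords X) (coords Y))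

  proportional⇒≡ : ∀ {X Y : Point} {c} → coords X ≡ c ⊛ coords Y → X ≡ Y
  proportional⇒≡ {X} {Y} X≡cY = coords-injective (normalised-proportional (proj₂ X) (proj₂ Y) X≡cY)

  finite-Point : Finite Point
  finite-Point =
    finite-Σ (finite-Vec finite-Carrier (suc n)) (λ v → finite-Dec (normalised? v) normalised-irrelevant)

  _∩ᵛ_ : PointSet → Vec Carrier (suc n) → Set
  K ∩ᵛ a = Σ Point (λ z → (K z ≡ true) × (dot a (coords z) ≡ 0#))

  ∩ᵛ-⊛ : ∀ {K c} a → ¬ c ≡ 0# → K ∩ᵛ (c ⊛ a) ↔ K ∩ᵛ a
  ∩ᵛ-⊛ {c = c} a c≢0 = Σ-↔ ↔-refl (↔-refl ×-↔ ⇔⇒↔ uip uip kernel-⊛)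
    where
    kernel-⊛ : ∀ {z} → dot (c ⊛ a) z ≡ 0# ⇔ dot a z ≡ 0#
    kernel-⊛ {z} = mk⇔ (x*y≡0⇒y≡0 c≢0 ∘ trans (sym (dot-⊛ˡ c a z)))
                       (λ az≡0 → trans (dot-⊛ˡ c a z) (trans (cong (c *_) az≡0) (zeroʳ c)))

  dot≢0⇒≢0ᵛ : ∀ {m} {a v : Vec Carrier m} → ¬ dot a v ≡ 0# → ¬ a ≡ 0ᵛ
  dot≢0⇒≢0ᵛ {v = v} av≢0 refl = av≢0 (dot-zeroˡ v)

  ∩ᵛ-equinumerous : ∀ P {K} → (∀ h h′ → ¬ (P ∈H h) → ¬ (P ∈H h′) → (K ∩ h) ↔ (K ∩ h′)) →
                    ∀ a b → ¬ dot a (coords P) ≡ 0# → ¬ dot b (coords P) ≡ 0# → K ∩ᵛ a ↔ K ∩ᵛ b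
  ∩ᵛ-equinumerous P hyp a b aP≢0 bP≢0
    with normalise a (dot≢0⇒≢0ᵛ aP≢0) | normalise b (dot≢0⇒≢0ᵛ bP≢0)
  ... | c , c≢0 , Na | d , d≢0 , Nb = ↔-trans (↔-sym (∩ᵛ-⊛ a c≢0))
    (↔-trans (hyp (c ⊛ a , Na) (d ⊛ b , Nb) (off-P a c≢0 aP≢0) (off-P b d≢0 bP≢0)) (∩ᵛ-⊛ b d≢0))
    where
    off-P : ∀ {c} a → ¬ c ≡ 0# → ¬ dot a (coords P) ≡ 0# → ¬ dot (c ⊛ a) (coords P) ≡ 0#
    off-P {c} a c≢0 aP≢0 = *-nonzero c≢0 aP≢0 ∘ trans (sym (dot-⊛ˡ c a (coords P)))

  module CountingArgument
    {P : Point} {K : PointSet}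
    (hyp : ∀ h h′ → ¬ (P ∈H h) → ¬ (P ∈H h′) → (K ∩ h) ↔ (K ∩ h′))
    {X Y : Point} {α β : Carrier} (X≢P : ¬ X ≡ P) (KX : K X ≡ true)
    (y≡αx+βp : coords Y ≡ α ⊛ coords X ⊕ β ⊛ coords P)
    (Y≢P : ¬ Y ≡ P) (Y≢X : ¬ Y ≡ X) (KY : K Y ≡ false)
    where

    V : Set
    V = Vec Carrier (suc n)

    p x y : V
    p = coords P
    x = coords X
    y = coords Y

    α≢0 : ¬ α ≡ 0#
    α≢0 refl = Y≢P (proportional⇒≡ (trans y≡αx+βp (0⊛-⊕ x (β ⊛ p))))

    β≢0 : ¬ β ≡ 0#
    β≢0 refl = Y≢X (proportional⇒≡ (trans y≡αx+βp (⊕-0⊛ (α ⊛ x) p)))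

    α⁻¹ : Carrier
    α⁻¹ = inv α α≢0

    t : Carrier
    t = - β * α⁻¹

    αt+β≡0 : α * t + β ≡ 0#
    αt+β≡0 = begin
      α * (- β * α⁻¹) + β   ≡⟨ cong (_+ β) (solve 3 (λ α b i → α :* (b :* i) := b :* (α :* i)) refl α (- β) α⁻¹) ⟩
      - β * (α * α⁻¹) + β   ≡⟨ cong (λ s → - β * s + β) (x*inv≡1 α α≢0) ⟩
      - β * 1# + β          ≡⟨ cong (_+ β) (*-identityʳ (- β)) ⟩
      - β + β               ≡⟨ -‿inverseˡ β ⟩
      0#                    ∎

    t≢0 : ¬ t ≡ 0#
    t≢0 t≡0 = β≢0 (begin
      β                 ≡⟨ sym (+-identityˡ β) ⟩
      0# + β            ≡⟨ cong (_+ β) (sym (trans (cong (α *_) t≡0) (zeroʳ α))) ⟩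
      α * t + β         ≡⟨ αt+β≡0 ⟩
      0#                ∎)

    -- A hyperplane missing P has a unique equation a with a·p = 1; since
    -- a·y = α (a·x) + β, Eqn 0# and Eqn t pick out those through X and through Y.
    Eqn : Carrier → V → Set
    Eqn s a = (dot a p ≡ 1#) × (dot a x ≡ s)

    Eqn-irrelevant : ∀ s a → Irrelevant (Eqn s a)
    Eqn-irrelevant s a = ×-irrelevant uip uip

    Fibre : Carrier → Point → Set
    Fibre s z = Σ V (λ a → Eqn s a × (dot a (coords z) ≡ 0#))

    KFibres : Carrier → Set
    KFibres s = Σ Point (λ z → (K z ≡ true) × Fibre s z)

    Incidences : Carrier → Set
    Incidences s = Σ (Σ V (Eqn s)) (λ (a , _) → K ∩ᵛ a)

    incidences-↔ : ∀ s → Incidences s ↔ KFibres s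
    incidences-↔ s = mk↔ₛ′ (λ ((a , e) , z , Kz , az) → z , Kz , a , e , az)
                           (λ (z , Kz , a , e , az) → (a , e) , z , Kz , az) (λ _ → refl) (λ _ → refl)

    finite-KFibres : ∀ s → Finite (KFibres s)
    finite-KFibres s = finite-Σ finite-Point λ z →
      finite-Σ (finite-Dec (K z Bool.≟ true) uip) λ _ →
      finite-Σ (finite-Vec finite-Carrier (suc n)) λ a →
      finite-Dec (((dot a p ≟ 1#) ×-dec (dot a x ≟ s)) ×-dec (dot a (coords z) ≟ 0#))
                 (×-irrelevant (Eqn-irrelevant s a) uip)

    translation-Eqn : ∀ u → dot u p ≡ 0# → dot u x ≡ 1# → ∀ a → Eqn 0# a ⇔ Eqn t (a ⊕ t ⊛ u)
    translation-Eqn u up≡0 ux≡1 a =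
      translation-value a u p up≡0 (trans (cong (1# +_) (zeroʳ t)) (+-identityʳ 1#))
      ×-⇔ translation-value a u x ux≡1 (trans (cong (0# +_) (*-identityʳ t)) (+-identityˡ t))

    translation-Eqns : ∀ u → dot u p ≡ 0# → dot u x ≡ 1# → Σ V (Eqn 0#) ↔ Σ V (Eqn t)
    translation-Eqns u up≡0 ux≡1 = Σ-↔ (translation t u) λ {a} →
      ⇔⇒↔ (Eqn-irrelevant 0# a) (Eqn-irrelevant t (a ⊕ t ⊛ u)) (translation-Eqn u up≡0 ux≡1 a)

    translation-Fibres : ∀ z u → dot u p ≡ 0# → dot u x ≡ 1# → dot u (coords z) ≡ 0# → Fibre 0# z ↔ Fibre t z
    translation-Fibres z u up≡0 ux≡1 uz≡0 = Σ-↔ (translation t u) λ {a} →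
      ⇔⇒↔ (irrelevant 0# a) (irrelevant t (a ⊕ t ⊛ u))
        (translation-Eqn u up≡0 ux≡1 a
         ×-⇔ translation-value a u (coords z) uz≡0 (trans (cong (0# +_) (zeroʳ t)) (+-identityˡ 0#)))
      where
      irrelevant : ∀ s a → Irrelevant (Eqn s a × dot a (coords z) ≡ 0#)
      irrelevant s a = ×-irrelevant (Eqn-irrelevant s a) uip

    P-annihilator : ∃[ u ] (dot u p ≡ 0# × dot u x ≡ 1#)
    P-annihilator with ∈Span⊎Separable (p ∷ []) x
    ... | inj₁ (c ∷ [] , x≡cp)        = ⊥-elim (X≢P (proportional⇒≡ (trans x≡cp (⊕-identityˡ (c ⊛ p)))))
    ... | inj₂ (u , up≡0 ∷ [] , ux≡1) = u , up≡0 , ux≡1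

    P-z-annihilator : ∀ z → Separable (p ∷ x ∷ []) (coords z) →
                      ∃[ u ] (dot u p ≡ 0# × dot u x ≡ 1# × dot u (coords z) ≡ 0#)
    P-z-annihilator z (u₂ , u₂p≡0 ∷ u₂x≡0 ∷ [] , u₂z≡1) with P-annihilator
    ... | u₁ , u₁p≡0 , u₁x≡1 = u₁ ⊕ e ⊛ u₂
      , trans (dot-translation u₁ u₂ p u₁p≡0 u₂p≡0) (trans (+-identityˡ _) (zeroʳ e))
      , trans (dot-translation u₁ u₂ x u₁x≡1 u₂x≡0) (trans (cong (1# +_) (zeroʳ e)) (+-identityʳ 1#))
      , trans (dot-translation u₁ u₂ (coords z) refl u₂z≡1)
              (trans (cong (dot u₁ (coords z) +_) (*-identityʳ e)) (-‿inverseʳ _))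
      where
      e : Carrier
      e = - dot u₁ (coords z)

    incidences₀↔incidencesₜ : Incidences 0# ↔ Incidences t
    incidences₀↔incidencesₜ with P-annihilator
    ... | u , up≡0 , ux≡1 = Σ-↔ Eqn₀↔Eqnₜ λ { {a , e} →
      let a′ , e′ = Inverse.to Eqn₀↔Eqnₜ (a , e)
      in ∩ᵛ-equinumerous P hyp a a′ (≡1⇒≢0 (proj₁ e)) (≡1⇒≢0 (proj₁ e′)) }
      where
      Eqn₀↔Eqnₜ : Σ V (Eqn 0#) ↔ Σ V (Eqn t)
      Eqn₀↔Eqnₜ = translation-Eqns u up≡0 ux≡1

    X∈Fibre₀ : Fibre 0# X
    X∈Fibre₀ with ∈Span⊎Separable (x ∷ []) p
    ... | inj₁ (c ∷ [] , p≡cx)        = ⊥-elim (X≢P (sym (proportional⇒≡ (trans p≡cx (⊕-identityˡ (c ⊛ x))))))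
    ... | inj₂ (a , ax≡0 ∷ [] , ap≡1) = a , (ap≡1 , ax≡0) , ax≡0

    X∉Fibreₜ : ¬ Fibre t X
    X∉Fibreₜ (_ , (_ , ax≡t) , ax≡0) = t≢0 (trans (sym ax≡t) ax≡0)

    onLine-X : ∀ {z c μ} → coords z ≡ c ⊛ x ⊕ μ ⊛ p → μ ≡ 0# → z ≡ X
    onLine-X {c = c} z≡ refl = proportional⇒≡ (trans z≡ (⊕-0⊛ (c ⊛ x) p))

    onLine-Y : ∀ {z c μ} → coords z ≡ c ⊛ x ⊕ μ ⊛ p → c * t + μ ≡ 0# → z ≡ Y
    onLine-Y {z} {c} {μ} z≡ ct+μ≡0 = proportional⇒≡ (begin
      coords z                       ≡⟨ z≡ ⟩
      c ⊛ x ⊕ μ ⊛ p                  ≡⟨ line-scale (c * α⁻¹) x p c≡ μ≡ ⟩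
      (c * α⁻¹) ⊛ (α ⊛ x ⊕ β ⊛ p)    ≡⟨ cong ((c * α⁻¹) ⊛_) (sym y≡αx+βp) ⟩
      (c * α⁻¹) ⊛ y                  ∎)
      where
      c≡ : c ≡ c * α⁻¹ * α
      c≡ = begin
        c                ≡⟨ sym (*-identityʳ c) ⟩
        c * 1#           ≡⟨ cong (c *_) (sym (inv*x≡1 α α≢0)) ⟩
        c * (α⁻¹ * α)    ≡⟨ sym (*-assoc c α⁻¹ α) ⟩
        c * α⁻¹ * α      ∎
      μ≡ : μ ≡ c * α⁻¹ * β
      μ≡ = ∙-cancelˡ (c * t) μ (c * α⁻¹ * β) (begin
        c * t + μ                         ≡⟨ ct+μ≡0 ⟩
        0#                                ≡⟨ sym (zeroʳ (c * α⁻¹)) ⟩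
        c * α⁻¹ * 0#                      ≡⟨ cong (c * α⁻¹ *_) (sym αt+β≡0) ⟩
        c * α⁻¹ * (α * t + β)             ≡⟨ solve 5 (λ c i α t β → c :* i :* (α :* t :+ β) := c :* (i :* α) :* t :+ c :* i :* β)
                                                   refl c α⁻¹ α t β ⟩
        c * (α⁻¹ * α) * t + c * α⁻¹ * β   ≡⟨ cong (λ s → c * s * t + c * α⁻¹ * β) (inv*x≡1 α α≢0) ⟩
        c * 1# * t + c * α⁻¹ * β          ≡⟨ cong (λ s → s * t + c * α⁻¹ * β) (*-identityʳ c) ⟩
        c * t + c * α⁻¹ * β               ∎)

    fibres-agree-off-X : ∀ z → K z ≡ true → ¬ z ≡ X → Fibre 0# z ↔ Fibre t z
    fibres-agree-off-X z Kz z≢X with ∈Span⊎Separable (p ∷ x ∷ []) (coords z)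
    ... | inj₂ z-separable = let u , up≡0 , ux≡1 , uz≡0 = P-z-annihilator z z-separable
                             in translation-Fibres z u up≡0 ux≡1 uz≡0
    ... | inj₁ (μ ∷ c ∷ [] , z≡) = ¬-↔
      (λ (a , e , az≡0) → z≢X (onLine-X z≡cx+μp (trans (sym (c*0+μ≡μ)) (line-value a e az≡0))))
      (λ (a , e , az≡0) → z≢Y (onLine-Y z≡cx+μp (line-value a e az≡0)))
      where
      z≡cx+μp : coords z ≡ c ⊛ x ⊕ μ ⊛ p
      z≡cx+μp = trans z≡ (cong (_⊕ μ ⊛ p) (⊕-identityˡ (c ⊛ x)))
      z≢Y : ¬ z ≡ Y
      z≢Y refl with () ← trans (sym Kz) KY
      c*0+μ≡μ : c * 0# + μ ≡ μ
      c*0+μ≡μ = trans (cong (_+ μ) (zeroʳ c)) (+-identityˡ μ)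
      line-value : ∀ {s} a → Eqn s a → dot a (coords z) ≡ 0# → c * s + μ ≡ 0#
      line-value {s} a (ap≡1 , ax≡s) az≡0 = begin
        c * s + μ                   ≡⟨ cong (c * s +_) (sym (*-identityʳ μ)) ⟩
        c * s + μ * 1#              ≡⟨ sym (cong₂ (λ r w → c * r + μ * w) ax≡s ap≡1) ⟩
        c * dot a x + μ * dot a p   ≡⟨ sym (trans (cong (dot a) z≡cx+μp) (dot-lineʳ c μ a x p)) ⟩
        dot a (coords z)            ≡⟨ az≡0 ⟩
        0#                          ∎

    KFibres₀↔KFibresₜ⊎Fibre₀X : KFibres 0# ↔ (KFibres t ⊎ (K X ≡ true × Fibre 0# X))
    KFibres₀↔KFibresₜ⊎Fibre₀X = Σ-split X _≟ₚ_
      (λ z z≢X → Σ-↔ ↔-refl (λ {Kz} → fibres-agree-off-X z Kz z≢X)) (X∉Fibreₜ ∘ proj₂)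

    impossible : ⊥
    impossible = finite-absorbs⇒empty (finite-KFibres t) KFibresₜ⊎Fibre₀X↔KFibresₜ (KX , X∈Fibre₀)
      where
      KFibresₜ⊎Fibre₀X↔KFibresₜ : (KFibres t ⊎ (K X ≡ true × Fibre 0# X)) ↔ KFibres t
      KFibresₜ⊎Fibre₀X↔KFibresₜ =
        ↔-trans (↔-sym KFibres₀↔KFibresₜ⊎Fibre₀X)
          (↔-trans (↔-sym (incidences-↔ 0#)) (↔-trans incidences₀↔incidencesₜ (incidences-↔ t)))

mainTheorem6 : (q : ℕ) (F : FiniteField q) (n : ℕ) →
    let open Projective F n in
    (P : Point) (K : PointSet) →
    (∀ h h′ → ¬ (P ∈H h) → ¬ (P ∈H h′) → (K ∩ h) ↔ (K ∩ h′)) →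
    IsConeWithVertex (InsertPt K P) P
mainTheorem6 q F n P K hyp = inj₂ refl , closed
  where
  open Projective F n
  open Geometry F n using (_≟ₚ_; module CountingArgument)
  closed : ∀ X → InsertPt K P X → ¬ X ≡ P → ∀ Y → OnLine X P Y → InsertPt K P Y
  closed X (inj₂ X≡P) X≢P _ _ = ⊥-elim (X≢P X≡P)
  closed X (inj₁ KX)  X≢P Y (α , β , y≡αx+βp) with Y ≟ₚ P | Y ≟ₚ X
  ... | yes Y≡P | _        = inj₂ Y≡P
  ... | no _    | yes refl = inj₁ KX
  ... | no Y≢P  | no Y≢X with K Y in KY
  ...   | true  = inj₁ refl
  ...   | false = ⊥-elim (CountingArgument.impossible hyp X≢P KX y≡αx+βp Y≢P Y≢X KY)
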